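{- Let $A$ be a finite set of atoms, $P$ and $R$ propositional Horn theories over $A$, and $I\subseteq A$. Let $1^I=\{a\leftarrow a\mid a\in I\}$. Then $${}^IP=1^I\circ P,\qquad P^I=P\circ 1^I,\qquad P|_I=1^I\circ P\circ 1^I,$$ and $${}^I(P\cup R)={}^IP\cup{}^IR,\quad {}^I(P\circ R)={}^IP\circ R,\quad (P\cup R)^I=P^I\cup R^I,\quad (P\circ R)^I=P\circ R^I.$$
   Context: A theory over $A$ is a finite set of rules $a_0\leftarrow a_1,\ldots,a_k$ ($k\ge0$, $a_i\in A$), with $head(r)=\{a_0\}$, $body(r)=\{a_1,\ldots,a_k\}$, size $k$; $head(S),body(S)$ are unions over a set $S$ of rules. Write $S\subseteq_r R$ if $S\subseteq R$ has as many elements as the size of $r$. Composition: $P\circ R=\{head(r)\leftarrow body(S)\mid r\in P,\ S\subseteq_r R,\ head(S)=body(r)\}$. Left reduct: ${}^IP=\{r\in P\mid head(r)\subseteq I\}$; right reduct: $P^I=\{r\in P\mid body(r)\subseteq I\}$; reduction to $I$: $P|_I={}^I(P^I)$. -}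

module Defs where

open import Data.Nat using (ℕ)
open import Data.Fin using (Fin)
open import Data.Fin.Subset using (Subset; _∈_; _⊆_; ⁅_⁆; _∪_; ∣_∣; ⊥)
open import Data.Product using (_×_; Σ; ∃; ∃-syntax; _,_; proj₁; proj₂)
open import Data.Sum using (_⊎_)
open import Data.List using (List; length; foldr)
open import Data.List.Relation.Unary.All using (All)
open import Data.List.Relation.Unary.Unique.Propositional using (Unique)
open import Relation.Binary.PropositionalEquality using (_≡_)
open import Function.Bundles using (_⇔_)

-- Atoms: the finite set A is Fin n.
-- A (propositional Horn) rule a₀ ← a₁,…,aₖ : a head atom and a body, which is a
-- (finite) set of atoms, represented as a Subset n.
Rule : ℕ → Set
Rule n = Fin n × Subset n

head : ∀ {n} → Rule n → Fin n
head = proj₁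

body : ∀ {n} → Rule n → Subset n
body = proj₂

size : ∀ {n} → Rule n → ℕ
size r = ∣ body r ∣

-- A theory is a set of rules (finite, since Rule n is a finite type),
-- represented by its membership predicate.
Theory : ℕ → Set₁
Theory n = Rule n → Set

_≐_ : ∀ {n} → Theory n → Theory n → Set
P ≐ Q = ∀ r → P r ⇔ Q r
infix 4 _≐_

heads : ∀ {n} → List (Rule n) → Subset n
heads = foldr (λ r acc → ⁅ head r ⁆ ∪ acc) ⊥

bodies : ∀ {n} → List (Rule n) → Subset n
bodies = foldr (λ r acc → body r ∪ acc) ⊥

_⊆[_]_ : ∀ {n} → List (Rule n) → Rule n → Theory n → Set
S ⊆[ r ] R = Unique S × All R S × length S ≡ size r

_∘ₜ_ : ∀ {n} → Theory n → Theory n → Theory n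
(P ∘ₜ R) r' = ∃[ r ] ∃[ S ] (P r × S ⊆[ r ] R × heads S ≡ body r
                             × head r' ≡ head r × body r' ≡ bodies S)
infixl 7 _∘ₜ_

_∪ₜ_ : ∀ {n} → Theory n → Theory n → Theory n
(P ∪ₜ R) r = P r ⊎ R r
infixl 6 _∪ₜ_

leftReduct : ∀ {n} → Subset n → Theory n → Theory n
leftReduct I P r = P r × head r ∈ I

rightReduct : ∀ {n} → Subset n → Theory n → Theory n
rightReduct I P r = P r × body r ⊆ I

reduction : ∀ {n} → Subset n → Theory n → Theory n
reduction I P = leftReduct I (rightReduct I P)

one : ∀ {n} → Subset n → Theory n
one I r = head r ∈ I × body r ≡ ⁅ head r ⁆

-- Both reducts restrict a theory by a condition on single rules: a condition on
-- the head for ᴵP, on the body for Pᴵ. Composing with 1ᴵ imposes exactly these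
-- conditions: in 1ᴵ ∘ P a rule a ← a (a ∈ I) selects a single rule of P with
-- head a, and in P ∘ 1ᴵ a rule of P is matched by the identity rules of its
-- body atoms, which exist iff the body lies in I. The distributivity laws hold
-- because a head condition on a composite rule is a condition on the head of
-- its first factor, and a body condition on it is a condition on each rule of
-- the chosen set S, since the body of the composite is the union of their bodies.
module Submission where

open import Defs
open import Data.Nat using (ℕ)
open import Data.Fin using (Fin; zero; suc)
open import Data.Fin.Properties using (suc-injective; 0≢1+n)
open import Data.Fin.Subset using (Subset; _∈_; _⊆_; ⁅_⁆; _∪_; ∣_∣; ⊥; inside; outside)
open import Data.Fin.Subset.Properties
  using (x∈⁅x⁆; x∈⁅y⁆⇒x≡y; ∣⁅x⁆∣≡1; ∪-identityˡ; ∪-identityʳ; x∈p∪q⁻; x∈p∪q⁺; ⊥⊆)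
open import Data.Product using (_×_; _,_; proj₁; ∃-syntax)
open import Data.Product.Properties using (×-≡,≡→≡)
open import Data.Sum using (inj₁; inj₂)
open import Data.Vec using ([]; _∷_)
open import Data.List using (List; []; _∷_; map; length; foldr)
open import Data.List.Properties using (length-map)
open import Data.List.Relation.Unary.All using (All; []; _∷_)
import Data.List.Relation.Unary.All as All
import Data.List.Relation.Unary.All.Properties as All
open import Data.List.Relation.Unary.AllPairs using ([]; _∷_)
open import Data.List.Relation.Unary.Unique.Propositional using (Unique)
import Data.List.Relation.Unary.Unique.Propositional.Properties as Unique
open import Relation.Binary.PropositionalEquality
open import Function.Bundles using (_⇔_; mk⇔; Equivalence)
import Function.Properties.Equivalence as ⇔

private
  variable
    n : ℕ
    A : Set
    P R R′ : Theory n
    I : Subset n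
    S : List (Rule n)

≐-trans : {P Q T : Theory n} → P ≐ Q → Q ≐ T → P ≐ T
≐-trans P≐Q Q≐T r = ⇔.trans (P≐Q r) (Q≐T r)

∘ₜ-monoʳ : (∀ {s} → R s → R′ s) → ∀ {r} → (P ∘ₜ R) r → (P ∘ₜ R′) r
∘ₜ-monoʳ R⊆R′ (r , S , Pr , (unique , RS , ∣S∣≡) , rest) =
  r , S , Pr , (unique , All.map R⊆R′ RS , ∣S∣≡) , rest

∘ₜ-congʳ : R ≐ R′ → P ∘ₜ R ≐ P ∘ₜ R′
∘ₜ-congʳ R≐R′ r =
  mk⇔ (∘ₜ-monoʳ (Equivalence.to (R≐R′ _))) (∘ₜ-monoʳ (Equivalence.from (R≐R′ _)))

-- ᴵP and Pᴵ are the instances C r = head r ∈ I and C r = body r ⊆ I.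
restrict : (Rule n → Set) → Theory n → Theory n
restrict C P r = P r × C r

restrict-cong : (C : Rule n → Set) → P ≐ R → restrict C P ≐ restrict C R
restrict-cong C P≐R r =
  mk⇔ (λ (p , c) → Equivalence.to (P≐R r) p , c) (λ (q , c) → Equivalence.from (P≐R r) q , c)

restrict-comm : (C D : Rule n → Set) (P : Theory n) →
  restrict C (restrict D P) ≐ restrict D (restrict C P)
restrict-comm C D P r = mk⇔ (λ ((p , d) , c) → (p , c) , d) (λ ((p , c) , d) → (p , d) , c)

restrict-∪ₜ : (C : Rule n → Set) (P R : Theory n) →
  restrict C (P ∪ₜ R) ≐ restrict C P ∪ₜ restrict C R
restrict-∪ₜ C P R r = mk⇔
  (λ { (inj₁ p , c) → inj₁ (p , c) ; (inj₂ q , c) → inj₂ (q , c) })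
  (λ { (inj₁ (p , c)) → inj₁ p , c ; (inj₂ (q , c)) → inj₂ q , c })

restrict-head-∘ₜ : (C : Fin n → Set) (P R : Theory n) →
  restrict (λ r → C (head r)) (P ∘ₜ R) ≐ restrict (λ r → C (head r)) P ∘ₜ R
restrict-head-∘ₜ C P R r′ = mk⇔
  (λ ((r , S , Pr , S⊆R , hS≡ , h′≡h , b′≡) , c) →
     r , S , (Pr , subst C h′≡h c) , S⊆R , hS≡ , h′≡h , b′≡)
  (λ (r , S , (Pr , c) , S⊆R , hS≡ , h′≡h , b′≡) →
     (r , S , Pr , S⊆R , hS≡ , h′≡h , b′≡) , subst C (sym h′≡h) c)

⋃-⊆⇔ : (f : A → Subset n) (xs : List A) →
  foldr (λ x acc → f x ∪ acc) ⊥ xs ⊆ I ⇔ All (λ x → f x ⊆ I) xs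
⋃-⊆⇔ {A = A} {I = I} f xs = mk⇔ (to xs) (from xs)
  where
  to : (xs : List A) → foldr (λ x acc → f x ∪ acc) ⊥ xs ⊆ I → All (λ x → f x ⊆ I) xs
  to []       _ = []
  to (x ∷ xs) ⋃⊆I = (λ m → ⋃⊆I (x∈p∪q⁺ (inj₁ m))) ∷ to xs (λ m → ⋃⊆I (x∈p∪q⁺ (inj₂ m)))
  from : (xs : List A) → All (λ x → f x ⊆ I) xs → foldr (λ x acc → f x ∪ acc) ⊥ xs ⊆ I
  from []       []             m = ⊥⊆ m
  from (x ∷ xs) (fx⊆I ∷ ⋃⊆I) m with x∈p∪q⁻ (f x) _ m
  ... | inj₁ m∈fx = fx⊆I m∈fx
  ... | inj₂ m∈⋃  = from xs ⋃⊆I m∈⋃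

⁅x⁆⊆p⇔x∈p : {x : Fin n} {p : Subset n} → ⁅ x ⁆ ⊆ p ⇔ x ∈ p
⁅x⁆⊆p⇔x∈p {x = x} {p} =
  mk⇔ (λ ⁅x⁆⊆p → ⁅x⁆⊆p (x∈⁅x⁆ x)) (λ x∈p {y} m → subst (_∈ p) (sym (x∈⁅y⁆⇒x≡y {x = y} x m)) x∈p)

heads-⊆⇔ : (S : List (Rule n)) → heads S ⊆ I ⇔ All (λ s → head s ∈ I) S
heads-⊆⇔ S = ⇔.trans (⋃-⊆⇔ (λ s → ⁅ head s ⁆) S)
  (mk⇔ (All.map (Equivalence.to ⁅x⁆⊆p⇔x∈p)) (All.map (Equivalence.from ⁅x⁆⊆p⇔x∈p)))

rightReduct-∘ₜ : (I : Subset n) (P R : Theory n) →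
  rightReduct I (P ∘ₜ R) ≐ P ∘ₜ rightReduct I R
rightReduct-∘ₜ I P R r′ = mk⇔
  (λ ((r , S , Pr , (unique , RS , ∣S∣≡) , hS≡ , h′≡h , b′≡bS) , b′⊆I) →
     let bodies⊆I = Equivalence.to (⋃-⊆⇔ body S) (subst (_⊆ I) b′≡bS b′⊆I)
     in r , S , Pr , (unique , All.zip (RS , bodies⊆I) , ∣S∣≡) , hS≡ , h′≡h , b′≡bS)
  (λ (r , S , Pr , (unique , RS⊆I , ∣S∣≡) , hS≡ , h′≡h , b′≡bS) →
     let (RS , bodies⊆I) = All.unzip RS⊆I
     in (r , S , Pr , (unique , RS , ∣S∣≡) , hS≡ , h′≡h , b′≡bS)
        , subst (_⊆ I) (sym b′≡bS) (Equivalence.from (⋃-⊆⇔ body S) bodies⊆I))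

heads≡bodies : All (one I) S → heads S ≡ bodies S
heads≡bodies []                    = refl
heads≡bodies ((_ , b≡⁅h⁆) ∷ oneS) = cong₂ _∪_ (sym b≡⁅h⁆) (heads≡bodies oneS)

All-singleton : {C : A → Set} {xs : List A} → All C xs → length xs ≡ 1 →
  ∃[ x ] xs ≡ x ∷ [] × C x
All-singleton (Cx ∷ []) refl = _ , refl , Cx

leftReduct≐one∘ₜ : (I : Subset n) (P : Theory n) → leftReduct I P ≐ one I ∘ₜ P
leftReduct≐one∘ₜ I P r′ = mk⇔ to from
  where
  to : leftReduct I P r′ → (one I ∘ₜ P) r′
  to (Pr′ , h′∈I) =
    (head r′ , ⁅ head r′ ⁆) , r′ ∷ [] , (h′∈I , refl)
    , ([] ∷ [] , Pr′ ∷ [] , sym (∣⁅x⁆∣≡1 (head r′)))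
    , ∪-identityʳ _ , refl , sym (∪-identityʳ _)
  -- The chosen set S has size ∣ ⁅ a ⁆ ∣ = 1, so it is a single rule of P with head a.
  from : (one I ∘ₜ P) r′ → leftReduct I P r′
  from (r , S , (h∈I , b≡⁅h⁆) , (_ , PS , ∣S∣≡) , hS≡b , h′≡h , b′≡bS)
    with All-singleton PS (trans ∣S∣≡ (trans (cong ∣_∣ b≡⁅h⁆) (∣⁅x⁆∣≡1 (head r))))
  ... | s , refl , Ps = subst P (sym r′≡s) Ps , subst (_∈ I) (sym h′≡h) h∈I
    where
    hs≡h : head s ≡ head r
    hs≡h = x∈⁅y⁆⇒x≡y (head r)
      (subst (head s ∈_) (trans hS≡b b≡⁅h⁆) (x∈p∪q⁺ (inj₁ (x∈⁅x⁆ (head s)))))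
    r′≡s : r′ ≡ s
    r′≡s = ×-≡,≡→≡ (trans h′≡h (sym hs≡h) , trans b′≡bS (∪-identityʳ (body s)))

elements : Subset n → List (Fin n)
elements []            = []
elements (inside  ∷ p) = zero ∷ map suc (elements p)
elements (outside ∷ p) = map suc (elements p)

elements-unique : (p : Subset n) → Unique (elements p)
elements-unique []            = []
elements-unique (inside  ∷ p) =
  All.map⁺ (All.universal (λ _ → 0≢1+n) (elements p)) ∷ Unique.map⁺ suc-injective (elements-unique p)
elements-unique (outside ∷ p) = Unique.map⁺ suc-injective (elements-unique p)

length-elements : (p : Subset n) → length (elements p) ≡ ∣ p ∣
length-elements []            = refl
length-elements (inside  ∷ p) = cong ℕ.suc (trans (length-map suc (elements p)) (length-elements p))
length-elements (outside ∷ p) = trans (length-map suc (elements p)) (length-elements p)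

identity : Fin n → Rule n
identity a = a , ⁅ a ⁆

identities : Subset n → List (Rule n)
identities p = map identity (elements p)

heads-map-identity-suc : (as : List (Fin n)) →
  heads (map identity (map suc as)) ≡ outside ∷ heads (map identity as)
heads-map-identity-suc []       = refl
heads-map-identity-suc (a ∷ as) rewrite heads-map-identity-suc as = refl

heads-identities : (p : Subset n) → heads (identities p) ≡ p
heads-identities [] = refl
heads-identities (inside ∷ p)
  rewrite heads-map-identity-suc (elements p) | heads-identities p = cong (inside ∷_) (∪-identityˡ p)
heads-identities (outside ∷ p)
  rewrite heads-map-identity-suc (elements p) | heads-identities p = refl

identities-one : {p : Subset n} → p ⊆ I → All (one I) (identities p)
identities-one {I = I} {p = p} p⊆I =
  All.map⁺ (All.map (λ a∈I → a∈I , refl) (All.map⁻ heads⊆I))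
  where
  heads⊆I : All (λ s → head s ∈ I) (identities p)
  heads⊆I = Equivalence.to (heads-⊆⇔ (identities p)) (subst (_⊆ I) (sym (heads-identities p)) p⊆I)

rightReduct≐∘ₜone : (I : Subset n) (P : Theory n) → rightReduct I P ≐ P ∘ₜ one I
rightReduct≐∘ₜone I P r′ = mk⇔ to from
  where
  to : rightReduct I P r′ → (P ∘ₜ one I) r′
  to (Pr′ , b′⊆I) =
    r′ , identities (body r′) , Pr′
    , ( Unique.map⁺ (cong head) (elements-unique (body r′)) , oneS
      , trans (length-map identity (elements (body r′))) (length-elements (body r′)))
    , heads-identities (body r′) , refl
    , sym (trans (sym (heads≡bodies oneS)) (heads-identities (body r′)))
    where
    oneS : All (one I) (identities (body r′))
    oneS = identities-one b′⊆I
  from : (P ∘ₜ one I) r′ → rightReduct I P r′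
  from (r , S , Pr , (_ , oneS , _) , hS≡b , h′≡h , b′≡bS) =
    subst P (sym r′≡r) Pr , subst (_⊆ I) (sym b′≡hS) hS⊆I
    where
    b′≡hS : body r′ ≡ heads S
    b′≡hS = trans b′≡bS (sym (heads≡bodies oneS))
    hS⊆I : heads S ⊆ I
    hS⊆I = Equivalence.from (heads-⊆⇔ S) (All.map proj₁ oneS)
    r′≡r : r′ ≡ r
    r′≡r = ×-≡,≡→≡ (h′≡h , trans b′≡hS hS≡b)

proposition4p2 : (n : ℕ) (P R : Theory n) (I : Subset n) →
    (leftReduct I P ≐ one I ∘ₜ P)
    × (rightReduct I P ≐ P ∘ₜ one I)
    × (reduction I P ≐ one I ∘ₜ (P ∘ₜ one I))
    × (reduction I P ≐ (one I ∘ₜ P) ∘ₜ one I)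
    × (leftReduct I (P ∪ₜ R) ≐ leftReduct I P ∪ₜ leftReduct I R)
    × (leftReduct I (P ∘ₜ R) ≐ leftReduct I P ∘ₜ R)
    × (rightReduct I (P ∪ₜ R) ≐ rightReduct I P ∪ₜ rightReduct I R)
    × (rightReduct I (P ∘ₜ R) ≐ P ∘ₜ rightReduct I R)
proposition4p2 n P R I =
    leftReduct≐one∘ₜ I P
  , rightReduct≐∘ₜone I P
  , ≐-trans (leftReduct≐one∘ₜ I (rightReduct I P)) (∘ₜ-congʳ (rightReduct≐∘ₜone I P))
  , ≐-trans (restrict-comm head∈I body⊆I P)
      (≐-trans (restrict-cong body⊆I (leftReduct≐one∘ₜ I P)) (rightReduct≐∘ₜone I (one I ∘ₜ P)))
  , restrict-∪ₜ head∈I P R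
  , restrict-head-∘ₜ (_∈ I) P R
  , restrict-∪ₜ body⊆I P R
  , rightReduct-∘ₜ I P R
  where
  head∈I body⊆I : Rule n → Set
  head∈I r = head r ∈ I
  body⊆I r = body r ⊆ I
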